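{- Let $n\ge 2$. For the balanced bistar tree on $n$ vertices, $D_{max} = \frac14\left(3(n-1)^2+1-(n\bmod 2)\right)$. For the quasistar tree on $n\ge 4$ vertices, $D_{max}=\frac12(n+3)(n-2)$. For the star tree on $n$ vertices, $D_{max}=\binom n2$.
   Context: A linear arrangement of a tree on $n$ vertices is a bijection $\pi$ from its vertex set to $\{1,\dots,n\}$; $D(\pi)=\sum_{\{u,v\}\in E}|\pi(u)-\pi(v)|$, and $D_{max}$ is the maximum of $D(\pi)$ over all linear arrangements. A star tree on $s$ vertices has one vertex (hub) adjacent to all others. A bistar tree on $n\ge 2$ vertices is obtained from two stars with $s_1,s_2$ vertices ($s_1+s_2=n$) by adding an edge between their hubs; its maximum degree is $k_1=\max(s_1,s_2)$. The balanced bistar tree has $k_1=\lceil n/2\rceil$, the quasistar tree has $k_1=n-2$, and the star tree has $k_1=n-1$. -}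

module Defs where

open import Data.Nat using (ℕ; zero; suc; _+_; _≤_; ∣_-_∣)
open import Data.Fin using (Fin; zero; suc; toℕ; _↑ˡ_; _↑ʳ_)
open import Data.Fin.Permutation using (Permutation′; _⟨$⟩ʳ_)
open import Data.List using (List; []; _∷_; map; _++_; allFin)
open import Data.Nat.ListAction using (sum)
open import Data.Product using (_×_; _,_; ∃; proj₁; proj₂)
open import Relation.Binary.PropositionalEquality using (_≡_)

Edges : ℕ → Set
Edges n = List (Fin n × Fin n)

-- A linear arrangement is a bijection Fin n → Fin n (positions 0..n-1
-- instead of 1..n; differences of positions are unaffected).
Arrangement : ℕ → Set
Arrangement n = Permutation′ n

D : ∀ {n} → Edges n → Arrangement n → ℕ
D E π = sum (map (λ e → ∣ toℕ (π ⟨$⟩ʳ (proj₁ e)) - toℕ (π ⟨$⟩ʳ (proj₂ e)) ∣) E)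

IsDmax : ∀ {n} → Edges n → ℕ → Set
IsDmax {n} E d = (∃ λ (π : Arrangement n) → D E π ≡ d) × (∀ (π : Arrangement n) → D E π ≤ d)

-- Bistar from a star on s₁ = suc a vertices and a star on s₂ = suc b vertices,
-- hubs joined by an edge. Vertex set Fin (suc a + suc b):
-- hub1 = 0, leaves1 = 1..a, hub2 = suc a, leaves2 = suc a + 1 .. suc a + b.
bistar : (a b : ℕ) → Edges (suc a + suc b)
bistar a b =
  (hub1 , hub2)
  ∷ (map (λ i → (hub1 , (suc i ↑ˡ suc b))) (allFin a)
     ++ map (λ j → (hub2 , (suc a ↑ʳ suc j))) (allFin b))
  where
    hub1 : Fin (suc a + suc b)
    hub1 = zero ↑ˡ suc b
    hub2 : Fin (suc a + suc b)
    hub2 = suc a ↑ʳ zero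

star : (m : ℕ) → Edges (suc m)
star m = map (λ i → (zero , suc i)) (allFin m)

-- Let N = n - 1 be the last position. In the path 0 … N of positions, x is at
-- distance at most max(x, N - x) from every other position, and any p, q satisfy
-- |p - q| + N ≤ max(p, N - p) + max(q, N - q). Bounding each leaf edge of a bistar
-- by the first estimate at the leaf and the hub edge by the second, and summing over
-- all vertices, gives D + N ≤ Σ_{x ≤ N} max(x, N - x) = (3N² + 4N + N mod 2) / 4.
-- Equality needs the hubs at the two ends and every leaf in the half of the path
-- away from its hub, which is possible when the two stars are balanced.
-- For the star, D is the total distance from the hub, Σ_x |p - x| = C(n, 2) - p(N - p).
-- For the quasistar with hubs at p, q and the second hub's leaf at y,
-- D = Σ_x |p - x| - |p - y| + |q - y|, and |q - y| < N + p(N - p) because q and y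
-- avoid p; hence D ≤ C(n, 2) + N - 2, attained by the order hub, leaf y, …, hub.

module Submission where

open import Defs
open import Data.Bool using (true; false)
open import Data.Fin using (Fin; zero; suc; toℕ; fromℕ; fromℕ<; _↑ˡ_; _↑ʳ_; _≟_)
open import Data.Fin.Permutation as Perm using (_⟨$⟩ʳ_; _⟨$⟩ˡ_; _∘ₚ_)
import Data.Fin.Permutation.Components as PC
open import Data.Fin.Properties
  using (toℕ<n; toℕ-injective; toℕ-fromℕ<; toℕ-↑ˡ; toℕ-↑ʳ; ↑ʳ-injective; toℕ-fromℕ; toℕ-inject₁; opposite-prop)
open import Data.List using (List; map; _++_; allFin; tabulate)
open import Data.List.Properties using (map-++; map-tabulate)
open import Data.Nat
  using (ℕ; zero; suc; _+_; _*_; _∸_; _^_; _%_; _/_; _≤_; _<_; _⊔_; ∣_-_∣; ⌈_/2⌉; ⌊_/2⌋; NonZero; z≤n; s≤s; s≤s⁻¹; z<s)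
open import Data.Nat.Combinatorics using (_C_; nC1≡n; nCk+nC[k+1]≡[n+1]C[k+1])
open import Data.Nat.DivMod using (m*n/n≡m; m%n<n)
open import Data.Nat.ListAction using (sum)
open import Data.Nat.ListAction.Properties using (sum-++)
open import Data.Nat.Properties hiding (_≟_)
open import Data.Nat.Tactic.RingSolver using (solve-∀)
open import Data.Product using (_×_; _,_; ∃)
open import Data.Sum using (inj₁; inj₂; [_,_]′)
open import Function using (_∘_; id)
open import Relation.Binary.PropositionalEquality
open import Relation.Nullary using (does; yes; no; contradiction)
open import Relation.Nullary.Decidable using (dec-true; dec-false)
open import Algebra.Properties.CommutativeMonoid.Sum +-0-commutativeMonoid
  using (sum-syntax; ∑-permute; sum-init-last; sum-cong-≗)
open import Algebra.Properties.CommutativeSemigroup +-commutativeSemigroup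
  using (x∙yz≈y∙xz; x∙yz≈xz∙y; xy∙z≈xz∙y; interchange)

∑-suc : ∀ {n} (f : Fin n → ℕ) → ∑[ i < n ] suc (f i) ≡ n + ∑[ i < n ] f i
∑-suc {zero}  f = refl
∑-suc {suc n} f = cong suc (trans (cong (f zero +_) (∑-suc (f ∘ suc))) (x∙yz≈y∙xz (f zero) n _))

∑-mono-≤ : ∀ {n} {f g : Fin n → ℕ} → (∀ i → f i ≤ g i) → ∑[ i < n ] f i ≤ ∑[ i < n ] g i
∑-mono-≤ {zero}  f≤g = z≤n
∑-mono-≤ {suc n} f≤g = +-mono-≤ (f≤g zero) (∑-mono-≤ (f≤g ∘ suc))

∑-↑ : ∀ m {n} (f : Fin (m + n) → ℕ) →
  ∑[ i < m + n ] f i ≡ ∑[ i < m ] f (i ↑ˡ n) + ∑[ j < n ] f (m ↑ʳ j)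
∑-↑ zero    f = refl
∑-↑ (suc m) f = trans (cong (f zero +_) (∑-↑ m (f ∘ suc))) (sym (+-assoc (f zero) _ _))

∑-toℕ-last : ∀ n (g : ℕ → ℕ) → ∑[ x < suc n ] g (toℕ x) ≡ ∑[ x < n ] g (toℕ x) + g n
∑-toℕ-last n g = trans (sum-init-last {n} (g ∘ toℕ))
  (cong₂ _+_ (sum-cong-≗ {n} (cong g ∘ toℕ-inject₁)) (cong g (toℕ-fromℕ n)))

sum-tabulate : ∀ {n} (f : Fin n → ℕ) → sum (tabulate f) ≡ ∑[ i < n ] f i
sum-tabulate {zero}  f = refl
sum-tabulate {suc n} f = cong (f zero +_) (sum-tabulate (f ∘ suc))

sum-map-allFin : ∀ {A : Set} {n} (h : A → ℕ) (f : Fin n → A) →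
  sum (map h (map f (allFin n))) ≡ ∑[ i < n ] h (f i)
sum-map-allFin h f = trans (cong (sum ∘ map h) (map-tabulate id f))
  (trans (cong sum (map-tabulate f h)) (sum-tabulate (h ∘ f)))

pos : ∀ {n} → Arrangement n → Fin n → ℕ
pos π v = toℕ (π ⟨$⟩ʳ v)

pos-injective : ∀ {n} (π : Arrangement n) {v w : Fin n} → pos π v ≡ pos π w → v ≡ w
pos-injective π {v} {w} eq = begin
  v                       ≡⟨ Perm.inverseˡ π ⟨
  π ⟨$⟩ˡ (π ⟨$⟩ʳ v)       ≡⟨ cong (π ⟨$⟩ˡ_) (toℕ-injective eq) ⟩
  π ⟨$⟩ˡ (π ⟨$⟩ʳ w)       ≡⟨ Perm.inverseˡ π ⟩
  w                       ∎
  where open ≡-Reasoning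

pos≤ : ∀ {N} (π : Arrangement (suc N)) v → pos π v ≤ N
pos≤ π v = ≤-pred (toℕ<n (π ⟨$⟩ʳ v))

pos-∘ₚ-reverse : ∀ {N} (σ : Arrangement (suc N)) v →
  pos (σ ∘ₚ Perm.reverse) v ≡ N ∸ toℕ (σ ⟨$⟩ʳ v)
pos-∘ₚ-reverse σ v = opposite-prop (σ ⟨$⟩ʳ v)

∑-pos : ∀ {n} (π : Arrangement n) (g : ℕ → ℕ) → ∑[ v < n ] g (pos π v) ≡ ∑[ x < n ] g (toℕ x)
∑-pos π g = sym (∑-permute (g ∘ toℕ) π)

IsDmax-offset : ∀ {n} {E : Edges n} {N W d} →
  (∀ π → D E π + N ≤ W) → (∃ λ π → D E π + N ≡ W) → d + N ≡ W → IsDmax E d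
IsDmax-offset {E = E} {N} {d = d} bound (π , attained) d+N≡W =
  (π , +-cancelʳ-≡ N (D E π) d (trans attained (sym d+N≡W))) ,
  λ π → +-cancelʳ-≤ N (D E π) d (subst (D E π + N ≤_) (sym d+N≡W) (bound π))

-- Distances on the path of positions

distSum : ℕ → ℕ → ℕ
distSum n p = ∑[ x < n ] ∣ p - toℕ x ∣

suc-C2 : ∀ n → suc n C 2 ≡ n + n C 2
suc-C2 n = trans (sym (nCk+nC[k+1]≡[n+1]C[k+1] n 1)) (cong (_+ n C 2) (nC1≡n n))

2*C2 : ∀ n → 2 * (suc n C 2) ≡ suc n * n
2*C2 zero    = refl
2*C2 (suc n) = begin
  2 * (suc (suc n) C 2)         ≡⟨ cong (2 *_) (suc-C2 (suc n)) ⟩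
  2 * (suc n + suc n C 2)       ≡⟨ *-distribˡ-+ 2 (suc n) _ ⟩
  2 * suc n + 2 * (suc n C 2)   ≡⟨ cong (2 * suc n +_) (2*C2 n) ⟩
  2 * suc n + suc n * n         ≡⟨ solve n ⟩
  suc (suc n) * suc n           ∎
  where
  open ≡-Reasoning
  solve : ∀ n → 2 * suc n + suc n * n ≡ suc (suc n) * suc n
  solve = solve-∀

∑-toℕ≡C2 : ∀ n → ∑[ x < n ] toℕ x ≡ n C 2
∑-toℕ≡C2 zero    = refl
∑-toℕ≡C2 (suc n) = trans (∑-suc {n} toℕ) (trans (cong (n +_) (∑-toℕ≡C2 n)) (sym (suc-C2 n)))

-- The positions left and right of p contribute C(p + 1, 2) and C(r + 1, 2).
distSum+p*r≡C2 : ∀ p r → distSum (suc (p + r)) p + p * r ≡ suc (p + r) C 2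
distSum+p*r≡C2 zero    r = trans (+-identityʳ _) (∑-toℕ≡C2 (suc r))
distSum+p*r≡C2 (suc p) r = begin
  suc p + distSum (suc (p + r)) p + (r + p * r)   ≡⟨ solve (distSum (suc (p + r)) p) p r ⟩
  suc (p + r) + (distSum (suc (p + r)) p + p * r) ≡⟨ cong (suc (p + r) +_) (distSum+p*r≡C2 p r) ⟩
  suc (p + r) + suc (p + r) C 2                   ≡⟨ suc-C2 (suc (p + r)) ⟨
  suc (suc p + r) C 2                             ∎
  where
  open ≡-Reasoning
  solve : ∀ s p r → suc p + s + (r + p * r) ≡ suc (p + r) + (s + p * r)
  solve = solve-∀

distSum+p*[N∸p]≡C2 : ∀ {N p} → p ≤ N → distSum (suc N) p + p * (N ∸ p) ≡ suc N C 2
distSum+p*[N∸p]≡C2 {N} {p} p≤N = subst (λ n → distSum (suc n) p + p * (N ∸ p) ≡ suc n C 2)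
  (m+[n∸m]≡n p≤N) (distSum+p*r≡C2 p (N ∸ p))

pathEcc : ℕ → ℕ → ℕ
pathEcc N x = x ⊔ (N ∸ x)

totalEcc : ℕ → ℕ
totalEcc N = ∑[ x < suc N ] pathEcc N (toℕ x)

∣-∣≤pathEcc : ∀ {N p} x → p ≤ N → ∣ p - x ∣ ≤ pathEcc N x
∣-∣≤pathEcc {N} {p} x p≤N with ≤-total p x
... | inj₁ p≤x = ≤-trans (≤-reflexive (m≤n⇒∣m-n∣≡n∸m p≤x))
  (≤-trans (m∸n≤m x p) (m≤m⊔n x (N ∸ x)))
... | inj₂ x≤p = ≤-trans (≤-reflexive (m≤n⇒∣n-m∣≡n∸m x≤p))
  (≤-trans (∸-monoˡ-≤ x p≤N) (m≤n⊔m x (N ∸ x)))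

∣-∣+N≤pathEcc+pathEcc : ∀ {N p q} → p ≤ N → q ≤ N → ∣ p - q ∣ + N ≤ pathEcc N p + pathEcc N q
∣-∣+N≤pathEcc+pathEcc {N} {p} {q} p≤N q≤N =
  [ (λ p≤q → ordered p≤q q≤N)
  , (λ q≤p → subst₂ _≤_ (cong (_+ N) (∣-∣-comm q p)) (+-comm (pathEcc N q) (pathEcc N p))
                         (ordered q≤p p≤N))
  ]′ (≤-total p q)
  where
  ordered : ∀ {p q} → p ≤ q → q ≤ N → ∣ p - q ∣ + N ≤ pathEcc N p + pathEcc N q
  ordered {p} {q} p≤q q≤N = begin
    ∣ p - q ∣ + N              ≡⟨ cong (_+ N) (m≤n⇒∣m-n∣≡n∸m p≤q) ⟩
    q ∸ p + N                  ≡⟨ +-∸-comm N p≤q ⟨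
    q + N ∸ p                  ≡⟨ cong (_∸ p) (+-comm q N) ⟩
    N + q ∸ p                  ≡⟨ +-∸-comm q (≤-trans p≤q q≤N) ⟩
    N ∸ p + q                  ≤⟨ +-mono-≤ (m≤n⊔m p (N ∸ p)) (m≤m⊔n q (N ∸ q)) ⟩
    pathEcc N p + pathEcc N q  ∎
    where open ≤-Reasoning

pathEcc-reflect : ∀ {N k} → k ≤ N → pathEcc N (N ∸ k) ≡ pathEcc N k
pathEcc-reflect {N} {k} k≤N = trans (cong ((N ∸ k) ⊔_) (m∸[m∸n]≡n k≤N)) (⊔-comm (N ∸ k) k)

pathEcc-lower : ∀ {N} x → x + x ≤ N → pathEcc N x ≡ N ∸ x
pathEcc-lower x 2x≤N = m≤n⇒m⊔n≡n (m+n≤o⇒m≤o∸n x 2x≤N)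

pathEcc-upper : ∀ {N} x → N ≤ x + x → pathEcc N x ≡ x
pathEcc-upper {N} x N≤2x = m≥n⇒m⊔n≡m (m≤n+o⇒m∸n≤o N x N≤2x)

pathEcc-suc : ∀ {N x} → x ≤ N → pathEcc (suc (suc N)) (suc x) ≡ suc (pathEcc N x)
pathEcc-suc {N} {x} x≤N = cong (suc x ⊔_) (+-∸-assoc 1 x≤N)

pathEcc-end : ∀ N → pathEcc N N ≡ N
pathEcc-end N = trans (cong (N ⊔_) (n∸n≡0 N)) (⊔-identityʳ N)

totalEcc-step : ∀ N → totalEcc (suc (suc N)) ≡ totalEcc N + (3 * N + 5)
totalEcc-step N = begin
  totalEcc (2 + N)
    ≡⟨ cong (2 + N +_) (∑-toℕ-last (suc N) (pathEcc (2 + N) ∘ suc)) ⟩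
  2 + N + (∑[ x < suc N ] pathEcc (2 + N) (suc (toℕ x)) + pathEcc (2 + N) (2 + N))
    ≡⟨ cong₂ (λ s e → 2 + N + (s + e))
         (sum-cong-≗ {suc N} (λ x → pathEcc-suc (≤-pred (toℕ<n x)))) (pathEcc-end (2 + N)) ⟩
  2 + N + (∑[ x < suc N ] suc (pathEcc N (toℕ x)) + (2 + N))
    ≡⟨ cong (λ s → 2 + N + (s + (2 + N))) (∑-suc {suc N} (pathEcc N ∘ toℕ)) ⟩
  2 + N + (suc N + totalEcc N + (2 + N))
    ≡⟨ solve N (totalEcc N) ⟩
  totalEcc N + (3 * N + 5) ∎
  where
  open ≡-Reasoning
  solve : ∀ N t → 2 + N + (suc N + t + (2 + N)) ≡ t + (3 * N + 5)
  solve = solve-∀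

-- The left summand is the paper's numerator 3N² + 1 - (n mod 2) for n = N + 1.
4*totalEcc : ∀ N → 3 * N ^ 2 + 1 ∸ suc N % 2 + 4 * N ≡ 4 * totalEcc N
4*totalEcc zero          = refl
4*totalEcc (suc zero)    = refl
4*totalEcc (suc (suc N)) = begin
  3 * (2 + N) ^ 2 + 1 ∸ s + 4 * (2 + N)         ≡⟨ cong (λ t → t ∸ s + 4 * (2 + N)) (expand N) ⟩
  3 * N ^ 2 + 1 + (12 * N + 12) ∸ s + 4 * (2 + N) ≡⟨ cong (_+ 4 * (2 + N)) (+-∸-comm (12 * N + 12) s≤) ⟩
  3 * N ^ 2 + 1 ∸ s + (12 * N + 12) + 4 * (2 + N) ≡⟨ regroup (3 * N ^ 2 + 1 ∸ s) N ⟩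
  3 * N ^ 2 + 1 ∸ s + 4 * N + 4 * (3 * N + 5)   ≡⟨ cong (_+ 4 * (3 * N + 5)) (4*totalEcc N) ⟩
  4 * totalEcc N + 4 * (3 * N + 5)              ≡⟨ *-distribˡ-+ 4 (totalEcc N) _ ⟨
  4 * (totalEcc N + (3 * N + 5))                ≡⟨ cong (4 *_) (totalEcc-step N) ⟨
  4 * totalEcc (2 + N)                          ∎
  where
  open ≡-Reasoning
  s : ℕ
  s = suc N % 2
  s≤ : s ≤ 3 * N ^ 2 + 1
  s≤ = ≤-trans (≤-pred (m%n<n (suc N) 2)) (m≤n+m 1 (3 * N ^ 2))
  expand : ∀ N → 3 * ((2 + N) * ((2 + N) * 1)) + 1 ≡ 3 * (N * (N * 1)) + 1 + (12 * N + 12)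
  expand = solve-∀
  regroup : ∀ t N → t + (12 * N + 12) + 4 * (2 + N) ≡ t + 4 * N + 4 * (3 * N + 5)
  regroup = solve-∀

transpose-left : ∀ {n} (i j : Fin n) → PC.transpose i j i ≡ j
transpose-left i j rewrite dec-true (i ≟ i) refl = refl

transpose-right : ∀ {n} (i j : Fin n) → PC.transpose i j j ≡ i
transpose-right i j with i ≟ j
... | yes refl rewrite dec-true (i ≟ i) refl = refl
... | no i≢j rewrite dec-false (j ≟ i) (i≢j ∘ sym) | dec-true (j ≟ j) refl = refl

transpose-other : ∀ {n} {i j k : Fin n} → k ≢ i → k ≢ j → PC.transpose i j k ≡ k
transpose-other {i = i} {j} {k} k≢i k≢j rewrite dec-false (k ≟ i) k≢i | dec-false (k ≟ j) k≢j = refl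

transpose-preserves : ∀ {n} (P : Fin n → Set) {i j k : Fin n} → P i → P j → P k → P (PC.transpose i j k)
transpose-preserves P {i} {j} {k} Pi Pj Pk with does (k ≟ i)
... | true = Pj
... | false with does (k ≟ j)
...   | true  = Pi
...   | false = Pk

-- Bistars

module Bistar (a b : ℕ) where

  hub₁ hub₂ : Fin (suc a + suc b)
  hub₁ = zero ↑ˡ suc b
  hub₂ = suc a ↑ʳ zero

  leaf₁ : Fin a → Fin (suc a + suc b)
  leaf₁ i = suc i ↑ˡ suc b

  leaf₂ : Fin b → Fin (suc a + suc b)
  leaf₂ j = suc a ↑ʳ suc j

  ∑-vertices : (f : Fin (suc a + suc b) → ℕ) →
    ∑[ v < suc a + suc b ] f v ≡ f hub₁ + ∑[ i < a ] f (leaf₁ i) + (f hub₂ + ∑[ j < b ] f (leaf₂ j))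
  ∑-vertices = ∑-↑ (suc a)

  D-bistar : (π : Arrangement (suc a + suc b)) → D (bistar a b) π ≡
    ∣ pos π hub₁ - pos π hub₂ ∣
      + (∑[ i < a ] ∣ pos π hub₁ - pos π (leaf₁ i) ∣ + ∑[ j < b ] ∣ pos π hub₂ - pos π (leaf₂ j) ∣)
  D-bistar π = cong (∣ pos π hub₁ - pos π hub₂ ∣ +_) (begin
    sum (map length (edges₁ ++ edges₂))           ≡⟨ cong sum (map-++ length edges₁ edges₂) ⟩
    sum (map length edges₁ ++ map length edges₂)  ≡⟨ sum-++ (map length edges₁) (map length edges₂) ⟩
    sum (map length edges₁) + sum (map length edges₂)
      ≡⟨ cong₂ _+_ (sum-map-allFin length (λ i → hub₁ , leaf₁ i))
                   (sum-map-allFin length (λ j → hub₂ , leaf₂ j)) ⟩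
    _ ∎)
    where
    open ≡-Reasoning
    length : Fin (suc a + suc b) × Fin (suc a + suc b) → ℕ
    length (u , v) = ∣ pos π u - pos π v ∣
    edges₁ edges₂ : List (Fin (suc a + suc b) × Fin (suc a + suc b))
    edges₁ = map (λ i → hub₁ , leaf₁ i) (allFin a)
    edges₂ = map (λ j → hub₂ , leaf₂ j) (allFin b)

  N : ℕ
  N = a + suc b

  module _ (π : Arrangement (suc a + suc b)) where

    private
      p q : ℕ
      p = pos π hub₁
      q = pos π hub₂

    D+N≡split : D (bistar a b) π + N ≡
      (∣ p - q ∣ + N) + (∑[ i < a ] ∣ p - pos π (leaf₁ i) ∣ + ∑[ j < b ] ∣ q - pos π (leaf₂ j) ∣)
    D+N≡split = trans (cong (_+ N) (D-bistar π)) (xy∙z≈xz∙y ∣ p - q ∣ _ N)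

    totalEcc≡split : totalEcc N ≡
      (pathEcc N p + pathEcc N q)
        + (∑[ i < a ] pathEcc N (pos π (leaf₁ i)) + ∑[ j < b ] pathEcc N (pos π (leaf₂ j)))
    totalEcc≡split = trans (sym (∑-pos π (pathEcc N)))
      (trans (∑-vertices (pathEcc N ∘ pos π)) (interchange (pathEcc N p) _ (pathEcc N q) _))

    D+N≤totalEcc : D (bistar a b) π + N ≤ totalEcc N
    D+N≤totalEcc = begin
      D (bistar a b) π + N
        ≡⟨ D+N≡split ⟩
      (∣ p - q ∣ + N) + (∑[ i < a ] ∣ p - pos π (leaf₁ i) ∣ + ∑[ j < b ] ∣ q - pos π (leaf₂ j) ∣)
        ≤⟨ +-mono-≤ (∣-∣+N≤pathEcc+pathEcc (pos≤ π hub₁) (pos≤ π hub₂))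
             (+-mono-≤ (∑-mono-≤ {a} (λ i → ∣-∣≤pathEcc _ (pos≤ π hub₁)))
                       (∑-mono-≤ {b} (λ j → ∣-∣≤pathEcc _ (pos≤ π hub₂)))) ⟩
      (pathEcc N p + pathEcc N q)
        + (∑[ i < a ] pathEcc N (pos π (leaf₁ i)) + ∑[ j < b ] pathEcc N (pos π (leaf₂ j)))
        ≡⟨ totalEcc≡split ⟨
      totalEcc N ∎
      where open ≤-Reasoning

    D+N≡totalEcc : p ≡ 0 → q ≡ N →
      (∀ i → pathEcc N (pos π (leaf₁ i)) ≡ pos π (leaf₁ i)) →
      (∀ j → pathEcc N (pos π (leaf₂ j)) ≡ N ∸ pos π (leaf₂ j)) →
      D (bistar a b) π + N ≡ totalEcc N
    D+N≡totalEcc p≡0 q≡N leaves₁-far leaves₂-far = begin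
      D (bistar a b) π + N
        ≡⟨ D+N≡split ⟩
      (∣ p - q ∣ + N) + (∑[ i < a ] ∣ p - pos π (leaf₁ i) ∣ + ∑[ j < b ] ∣ q - pos π (leaf₂ j) ∣)
        ≡⟨ cong₂ _+_ hubs (cong₂ _+_ (sum-cong-≗ {a} leaves₁) (sum-cong-≗ {b} leaves₂)) ⟩
      (pathEcc N p + pathEcc N q)
        + (∑[ i < a ] pathEcc N (pos π (leaf₁ i)) + ∑[ j < b ] pathEcc N (pos π (leaf₂ j)))
        ≡⟨ totalEcc≡split ⟨
      totalEcc N ∎
      where
      open ≡-Reasoning
      hubs : ∣ p - q ∣ + N ≡ pathEcc N p + pathEcc N q
      hubs = trans (cong₂ (λ x y → ∣ x - y ∣ + N) p≡0 q≡N)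
        (cong₂ _+_ (cong (pathEcc N) (sym p≡0)) (trans (sym (pathEcc-end N)) (cong (pathEcc N) (sym q≡N))))
      leaves₁ : ∀ i → ∣ p - pos π (leaf₁ i) ∣ ≡ pathEcc N (pos π (leaf₁ i))
      leaves₁ i = trans (cong (∣_- pos π (leaf₁ i) ∣) p≡0) (sym (leaves₁-far i))
      leaves₂ : ∀ j → ∣ q - pos π (leaf₂ j) ∣ ≡ pathEcc N (pos π (leaf₂ j))
      leaves₂ j = trans (cong (∣_- pos π (leaf₂ j) ∣) q≡N)
        (trans (m≤n⇒∣n-m∣≡n∸m (pos≤ π (leaf₂ j))) (sym (leaves₂-far j)))

  last : Fin (suc a + suc b)
  last = fromℕ N

  toℕ-hub₂ : toℕ hub₂ ≡ suc a
  toℕ-hub₂ = trans (toℕ-↑ʳ (suc a) zero) (+-identityʳ (suc a))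

  toℕ-leaf₁ : ∀ i → toℕ (leaf₁ i) ≡ suc (toℕ i)
  toℕ-leaf₁ i = cong suc (toℕ-↑ˡ i (suc b))

  toℕ-leaf₂ : ∀ j → toℕ (leaf₂ j) ≡ suc a + suc (toℕ j)
  toℕ-leaf₂ j = toℕ-↑ʳ (suc a) (suc j)

  -- Hubs at the two ends, every leaf in the half of the path away from its hub.
  balanced : Arrangement (suc a + suc b)
  balanced = (Perm.transpose hub₁ hub₂ ∘ₚ Perm.transpose hub₂ last) ∘ₚ Perm.reverse

  D-balanced : a ≤ suc b → b ≤ suc a → D (bistar a b) balanced + N ≡ totalEcc N
  D-balanced a≤1+b b≤1+a = D+N≡totalEcc balanced hub₁-first hub₂-last leaves₁-far leaves₂-far
    where
    σ : Fin (suc a + suc b) → Fin (suc a + suc b)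
    σ v = PC.transpose hub₂ last (PC.transpose hub₁ hub₂ v)

    a<N : a < N
    a<N = m<m+n a z<s

    pos-balanced : ∀ v → pos balanced v ≡ N ∸ toℕ (σ v)
    pos-balanced = pos-∘ₚ-reverse (Perm.transpose hub₁ hub₂ ∘ₚ Perm.transpose hub₂ last)

    toℕ-≢ : ∀ {v w : Fin (suc a + suc b)} → toℕ v ≢ toℕ w → v ≢ w
    toℕ-≢ ne = ne ∘ cong toℕ

    hub₁≢last : hub₁ ≢ last
    hub₁≢last = toℕ-≢ (λ e → <⇒≢ (≤-<-trans z≤n a<N) (trans e (toℕ-fromℕ N)))

    σ-hub₁ : σ hub₁ ≡ last
    σ-hub₁ = trans (cong (PC.transpose hub₂ last) (transpose-left hub₁ hub₂)) (transpose-left hub₂ last)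

    σ-hub₂ : σ hub₂ ≡ hub₁
    σ-hub₂ = trans (cong (PC.transpose hub₂ last) (transpose-right hub₁ hub₂))
      (transpose-other {i = hub₂} (λ ()) hub₁≢last)

    hub₁-first : pos balanced hub₁ ≡ 0
    hub₁-first = begin
      pos balanced hub₁  ≡⟨ pos-balanced hub₁ ⟩
      N ∸ toℕ (σ hub₁)   ≡⟨ cong (λ v → N ∸ toℕ v) σ-hub₁ ⟩
      N ∸ toℕ last       ≡⟨ cong (N ∸_) (toℕ-fromℕ N) ⟩
      N ∸ N              ≡⟨ n∸n≡0 N ⟩
      0                  ∎
      where open ≡-Reasoning

    hub₂-last : pos balanced hub₂ ≡ N
    hub₂-last = trans (pos-balanced hub₂) (cong (λ v → N ∸ toℕ v) σ-hub₂)

    leaves₁-far : ∀ i → pathEcc N (pos balanced (leaf₁ i)) ≡ pos balanced (leaf₁ i)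
    leaves₁-far i = subst (λ x → pathEcc N x ≡ x) (sym pos-leaf₁)
      (trans (pathEcc-reflect (≤-trans k≤a (<⇒≤ a<N)))
             (pathEcc-lower k (+-mono-≤ k≤a (≤-trans k≤a a≤1+b))))
      where
      k : ℕ
      k = suc (toℕ i)
      k≤a : k ≤ a
      k≤a = toℕ<n i
      ≢hub₂ : leaf₁ i ≢ hub₂
      ≢hub₂ = toℕ-≢ (λ e → <⇒≢ (s≤s k≤a) (trans (sym (toℕ-leaf₁ i)) (trans e toℕ-hub₂)))
      ≢last : leaf₁ i ≢ last
      ≢last = toℕ-≢ (λ e →
        <⇒≢ (≤-<-trans k≤a a<N) (trans (sym (toℕ-leaf₁ i)) (trans e (toℕ-fromℕ N))))
      σ-fixes : σ (leaf₁ i) ≡ leaf₁ i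
      σ-fixes = trans (cong (PC.transpose hub₂ last) (transpose-other {i = hub₁} {hub₂} (λ ()) ≢hub₂))
        (transpose-other ≢hub₂ ≢last)
      pos-leaf₁ : pos balanced (leaf₁ i) ≡ N ∸ k
      pos-leaf₁ = trans (pos-balanced (leaf₁ i)) (cong (N ∸_) (trans (cong toℕ σ-fixes) (toℕ-leaf₁ i)))

    leaves₂-far : ∀ j → pathEcc N (pos balanced (leaf₂ j)) ≡ N ∸ pos balanced (leaf₂ j)
    leaves₂-far j = subst (λ x → pathEcc N x ≡ N ∸ x) (sym (pos-balanced (leaf₂ j)))
      (trans (pathEcc-reflect t≤N) (trans (pathEcc-upper t N≤t+t) (sym (m∸[m∸n]≡n t≤N))))
      where
      t : ℕ
      t = toℕ (σ (leaf₂ j))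
      t≤N : t ≤ N
      t≤N = ≤-pred (toℕ<n (σ (leaf₂ j)))
      ≢hub₂ : leaf₂ j ≢ hub₂
      ≢hub₂ = (λ ()) ∘ ↑ʳ-injective (suc a) (suc j) zero
      1+a≤t : suc a ≤ t
      1+a≤t = subst (λ v → suc a ≤ toℕ (PC.transpose hub₂ last v))
        (sym (transpose-other {i = hub₁} {hub₂} (λ ()) ≢hub₂))
        (transpose-preserves (λ v → suc a ≤ toℕ v)
          (≤-reflexive (sym toℕ-hub₂))
          (subst (suc a ≤_) (sym (toℕ-fromℕ N)) a<N)
          (subst (suc a ≤_) (sym (toℕ-leaf₂ j)) (m≤m+n (suc a) _)))
      N≤t+t : N ≤ t + t
      N≤t+t = ≤-trans (≤-trans (≤-reflexive (+-suc a b)) (s≤s (+-monoʳ-≤ a b≤1+a)))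
        (+-mono-≤ 1+a≤t 1+a≤t)

  IsDmax-balanced : a ≤ suc b → b ≤ suc a → ∀ {d} → d + N ≡ totalEcc N → IsDmax (bistar a b) d
  IsDmax-balanced a≤1+b b≤1+a =
    IsDmax-offset {E = bistar a b} D+N≤totalEcc (balanced , D-balanced a≤1+b b≤1+a)

-- Quasistars

-- p (N - p) vanishes only when p is an end of 0 … N, and then q, y avoid that end.
∣-∣<N+p*[N∸p] : ∀ {N p q y} → p ≤ N → q ≤ N → y ≤ N → p ≢ q → p ≢ y →
  ∣ q - y ∣ < N + p * (N ∸ p)
∣-∣<N+p*[N∸p] {N} {zero} {zero}  {y}     _ _ _ p≢q _ = contradiction refl p≢q
∣-∣<N+p*[N∸p] {N} {zero} {suc q} {zero}  _ _ _ _ p≢y = contradiction refl p≢y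
∣-∣<N+p*[N∸p] {N} {zero} {suc q} {suc y} _ q<N y<N _ _ =
  ≤-trans (s≤s (∣m-n∣≤m⊔n q y)) (≤-trans (⊔-lub q<N y<N) (m≤m+n N 0))
∣-∣<N+p*[N∸p] {N} {suc p} {q} {y} p≤N q≤N y≤N p≢q p≢y with m≤n⇒m<n∨m≡n p≤N
... | inj₁ p<N = ≤-trans (s≤s (≤-trans (∣m-n∣≤m⊔n q y) (⊔-lub q≤N y≤N)))
  (subst (_≤ N + suc p * (N ∸ suc p)) (+-comm N 1)
    (+-monoʳ-≤ N (*-mono-≤ {1} {suc p} (s≤s z≤n) (m<n⇒0<n∸m p<N))))
... | inj₂ p≡N = ≤-trans (s≤s (∣m-n∣≤m⊔n q y))
  (≤-trans (⊔-lub (below q≤N p≢q) (below y≤N p≢y)) (m≤m+n N (suc p * (N ∸ suc p))))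
  where
  below : ∀ {x} → x ≤ N → suc p ≢ x → x < N
  below x≤N p≢x = ≤∧≢⇒< x≤N (λ x≡N → p≢x (trans p≡N (sym x≡N)))

module Quasistar (a : ℕ) where

  open Bistar a 1 using (hub₁; hub₂; leaf₁; leaf₂; ∑-vertices; D-bistar; toℕ-leaf₂)

  D+∣p-y∣≡ : ∀ π →
    D (bistar a 1) π + ∣ pos π hub₁ - pos π (leaf₂ zero) ∣
      ≡ distSum (suc a + 2) (pos π hub₁) + ∣ pos π hub₂ - pos π (leaf₂ zero) ∣
  D+∣p-y∣≡ π = begin
    D (bistar a 1) π + ∣ p - y ∣
      ≡⟨ cong (_+ ∣ p - y ∣) (D-bistar π) ⟩
    ∣ p - q ∣ + (S + (∣ q - y ∣ + 0)) + ∣ p - y ∣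
      ≡⟨ solve ∣ p - q ∣ S ∣ q - y ∣ ∣ p - y ∣ ⟩
    0 + S + (∣ p - q ∣ + (∣ p - y ∣ + 0)) + ∣ q - y ∣
      ≡⟨ cong (λ z → z + S + (∣ p - q ∣ + (∣ p - y ∣ + 0)) + ∣ q - y ∣) (∣n-n∣≡0 p) ⟨
    ∣ p - p ∣ + S + (∣ p - q ∣ + (∣ p - y ∣ + 0)) + ∣ q - y ∣
      ≡⟨ cong (_+ ∣ q - y ∣) (trans (sym (∑-pos π (∣ p -_∣))) (∑-vertices (λ v → ∣ p - pos π v ∣))) ⟨
    distSum (suc a + 2) p + ∣ q - y ∣ ∎
    where
    open ≡-Reasoning
    p q y S : ℕ
    p = pos π hub₁
    q = pos π hub₂
    y = pos π (leaf₂ zero)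
    S = ∑[ i < a ] ∣ p - pos π (leaf₁ i) ∣
    solve : ∀ x s u w → x + (s + (u + 0)) + w ≡ 0 + s + (x + (w + 0)) + u
    solve = solve-∀

  D+2≤ : ∀ π → D (bistar a 1) π + 2 ≤ (suc a + 2) C 2 + (a + 2)
  D+2≤ π = begin
    D (bistar a 1) π + 2                  ≡⟨ +-suc (D (bistar a 1) π) 1 ⟩
    suc (D (bistar a 1) π + 1)            ≤⟨ s≤s (+-monoʳ-≤ (D (bistar a 1) π) 1≤∣p-y∣) ⟩
    suc (D (bistar a 1) π + ∣ p - y ∣)    ≡⟨ cong suc (D+∣p-y∣≡ π) ⟩
    suc (S + ∣ q - y ∣)                   ≡⟨ +-suc S ∣ q - y ∣ ⟨
    S + suc ∣ q - y ∣                     ≤⟨ +-monoʳ-≤ S q-y-bound ⟩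
    S + (N + p * (N ∸ p))                 ≡⟨ x∙yz≈xz∙y S N (p * (N ∸ p)) ⟩
    S + p * (N ∸ p) + N                   ≡⟨ cong (_+ N) (distSum+p*[N∸p]≡C2 (pos≤ π hub₁)) ⟩
    suc N C 2 + N                         ∎
    where
    open ≤-Reasoning
    N p q y S : ℕ
    N = a + 2
    p = pos π hub₁
    q = pos π hub₂
    y = pos π (leaf₂ zero)
    S = distSum (suc N) p
    p≢q : p ≢ q
    p≢q = (λ ()) ∘ pos-injective π
    p≢y : p ≢ y
    p≢y = (λ ()) ∘ pos-injective π
    1≤∣p-y∣ : 1 ≤ ∣ p - y ∣
    1≤∣p-y∣ = n≢0⇒n>0 (p≢y ∘ ∣m-n∣≡0⇒m≡n)
    q-y-bound : ∣ q - y ∣ < N + p * (N ∸ p)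
    q-y-bound = ∣-∣<N+p*[N∸p] (pos≤ π hub₁) (pos≤ π hub₂) (pos≤ π (leaf₂ zero)) p≢q p≢y

  1<n : 1 < suc a + 2
  1<n = s≤s (≤-trans (s≤s z≤n) (m≤n+m 2 a))

  second : Fin (suc a + 2)
  second = fromℕ< 1<n

  -- Hub₁ first, the leaf of hub₂ second, hub₂ last.
  optimal : Arrangement (suc a + 2)
  optimal = Perm.transpose hub₂ (leaf₂ zero) ∘ₚ Perm.transpose second hub₂

  D-optimal : D (bistar a 1) optimal + 2 ≡ (suc a + 2) C 2 + (a + 2)
  D-optimal = begin
    D (bistar a 1) optimal + 2
      ≡⟨ +-suc (D (bistar a 1) optimal) 1 ⟩
    suc (D (bistar a 1) optimal + ∣ 0 - 1 ∣)
      ≡⟨ cong₂ (λ p y → suc (D (bistar a 1) optimal + ∣ p - y ∣)) (sym pos-hub₁) (sym pos-leaf) ⟩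
    suc (D (bistar a 1) optimal + ∣ pos optimal hub₁ - pos optimal (leaf₂ zero) ∣)
      ≡⟨ cong suc (D+∣p-y∣≡ optimal) ⟩
    suc (distSum (suc a + 2) (pos optimal hub₁) + ∣ pos optimal hub₂ - pos optimal (leaf₂ zero) ∣)
      ≡⟨ cong₂ (λ p z → suc (distSum (suc a + 2) p + z)) pos-hub₁ (cong₂ ∣_-_∣ pos-hub₂ pos-leaf) ⟩
    suc (distSum (suc a + 2) 0 + ∣ suc a + 1 - 1 ∣)
      ≡⟨ cong₂ (λ s z → suc (s + z)) (∑-toℕ≡C2 (suc a + 2)) (∣-∣-identityʳ (a + 1)) ⟩
    suc ((suc a + 2) C 2 + (a + 1))
      ≡⟨ +-suc ((suc a + 2) C 2) (a + 1) ⟨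
    (suc a + 2) C 2 + suc (a + 1)
      ≡⟨ cong ((suc a + 2) C 2 +_) (+-suc a 1) ⟨
    (suc a + 2) C 2 + (a + 2) ∎
    where
    open ≡-Reasoning
    toℕ-second : toℕ second ≡ 1
    toℕ-second = toℕ-fromℕ< 1<n
    leaf≢hub₂ : leaf₂ zero ≢ hub₂
    leaf≢hub₂ = (λ ()) ∘ ↑ʳ-injective (suc a) (suc zero) zero
    leaf≢second : leaf₂ zero ≢ second
    leaf≢second e = 0≢1+n (sym (trans (sym (+-comm a 1))
      (suc-injective (trans (sym (toℕ-leaf₂ zero)) (trans (cong toℕ e) toℕ-second)))))
    pos-hub₁ : pos optimal hub₁ ≡ 0
    pos-hub₁ = cong toℕ (trans
      (cong (PC.transpose second hub₂) (transpose-other {i = hub₂} {leaf₂ zero} {hub₁} (λ ()) (λ ())))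
      (transpose-other {i = second} {hub₂} (λ e → 0≢1+n (trans (cong toℕ e) toℕ-second)) (λ ())))
    pos-hub₂ : pos optimal hub₂ ≡ suc a + 1
    pos-hub₂ = trans (cong toℕ (trans (cong (PC.transpose second hub₂) (transpose-left hub₂ (leaf₂ zero)))
      (transpose-other leaf≢second leaf≢hub₂))) (toℕ-leaf₂ zero)
    pos-leaf : pos optimal (leaf₂ zero) ≡ 1
    pos-leaf = trans (cong toℕ (trans (cong (PC.transpose second hub₂) (transpose-right hub₂ (leaf₂ zero)))
      (transpose-right second hub₂))) toℕ-second

  IsDmax-quasistar : IsDmax (bistar a 1) ((suc a + 2) C 2 + a)
  IsDmax-quasistar =
    IsDmax-offset {E = bistar a 1} D+2≤ (optimal , D-optimal) (+-assoc ((suc a + 2) C 2) a 2)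

-- Stars

D-star : ∀ m (π : Arrangement (suc m)) → D (star m) π ≡ distSum (suc m) (pos π zero)
D-star m π = begin
  D (star m) π                         ≡⟨ sum-map-allFin length (λ i → zero , suc i) ⟩
  ∑[ i < m ] ∣ p - pos π (suc i) ∣     ≡⟨ cong (_+ ∑[ i < m ] ∣ p - pos π (suc i) ∣) (∣n-n∣≡0 p) ⟨
  ∑[ v < suc m ] ∣ p - pos π v ∣       ≡⟨ ∑-pos π (∣ p -_∣) ⟩
  distSum (suc m) p                    ∎
  where
  open ≡-Reasoning
  p : ℕ
  p = pos π zero
  length : Fin (suc m) × Fin (suc m) → ℕ
  length (u , v) = ∣ pos π u - pos π v ∣

IsDmax-star : ∀ m → IsDmax (star m) (suc m C 2)
IsDmax-star m = (Perm.id , trans (D-star m Perm.id) (∑-toℕ≡C2 (suc m))) , λ π →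
  subst (_≤ suc m C 2) (sym (D-star m π))
    (≤-trans (m≤m+n _ _) (≤-reflexive (distSum+p*[N∸p]≡C2 (pos≤ π zero))))

balanced-sizes : ∀ a b → suc a ≡ ⌈ suc a + suc b /2⌉ → a ≤ suc b × b ≤ a
balanced-sizes a b 1+a≡⌈n/2⌉ =
  s≤s⁻¹ (subst₂ _≤_ (sym 1+a≡⌈n/2⌉) (cong suc ⌊n/2⌋≡1+b) (⌊n/2⌋-mono (n≤1+n (suc n)))) ,
  s≤s⁻¹ (subst₂ _≤_ ⌊n/2⌋≡1+b (sym 1+a≡⌈n/2⌉) (⌊n/2⌋≤⌈n/2⌉ n))
  where
  n : ℕ
  n = suc a + suc b
  ⌊n/2⌋≡1+b : ⌊ n /2⌋ ≡ suc b
  ⌊n/2⌋≡1+b = +-cancelʳ-≡ (suc a) ⌊ n /2⌋ (suc b)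
    (trans (cong (⌊ n /2⌋ +_) 1+a≡⌈n/2⌉) (trans (⌊n/2⌋+⌈n/2⌉≡n n) (+-comm (suc a) (suc b))))

m+k*n≡k*w⇒m/k+n≡w : ∀ k .{{_ : NonZero k}} {m n w} → m + k * n ≡ k * w → m / k + n ≡ w
m+k*n≡k*w⇒m/k+n≡w k {m} {n} {w} eq = begin
  m / k + n             ≡⟨ cong (λ x → x / k + n) m≡[w∸n]*k ⟩
  (w ∸ n) * k / k + n   ≡⟨ cong (_+ n) (m*n/n≡m (w ∸ n) k) ⟩
  w ∸ n + n             ≡⟨ m∸n+n≡m n≤w ⟩
  w                     ∎
  where
  open ≡-Reasoning
  n≤w : n ≤ w
  n≤w = *-cancelˡ-≤ k (≤-trans (m≤n+m (k * n) m) (≤-reflexive eq))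
  m≡[w∸n]*k : m ≡ (w ∸ n) * k
  m≡[w∸n]*k = begin
    m                   ≡⟨ m+n∸n≡m m (k * n) ⟨
    m + k * n ∸ k * n   ≡⟨ cong (_∸ k * n) eq ⟩
    k * w ∸ k * n       ≡⟨ *-distribˡ-∸ k w n ⟨
    k * (w ∸ n)         ≡⟨ *-comm k (w ∸ n) ⟩
    (w ∸ n) * k         ∎

quasistar-value : ∀ a → ((suc a + 2 + 3) * (suc a + 2 ∸ 2)) / 2 ≡ (suc a + 2) C 2 + a
quasistar-value a = trans (cong (_/ 2) (begin
  (suc a + 2 + 3) * (suc a + 2 ∸ 2)       ≡⟨ cong ((suc a + 2 + 3) *_) (m+n∸n≡m (suc a) 2) ⟩
  (suc a + 2 + 3) * suc a                 ≡⟨ solve a ⟩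
  suc (a + 2) * (a + 2) + 2 * a           ≡⟨ cong (_+ 2 * a) (2*C2 (a + 2)) ⟨
  2 * ((suc a + 2) C 2) + 2 * a           ≡⟨ *-distribˡ-+ 2 ((suc a + 2) C 2) a ⟨
  2 * ((suc a + 2) C 2 + a)               ≡⟨ *-comm 2 ((suc a + 2) C 2 + a) ⟩
  ((suc a + 2) C 2 + a) * 2               ∎))
  (m*n/n≡m ((suc a + 2) C 2 + a) 2)
  where
  open ≡-Reasoning
  solve : ∀ a → (suc a + 2 + 3) * suc a ≡ suc (a + 2) * (a + 2) + 2 * a
  solve = solve-∀

corollary2 : ((a b : ℕ) → suc a ≡ ⌈ suc a + suc b /2⌉ →
    IsDmax (bistar a b) ((3 * ((suc a + suc b) ∸ 1) ^ 2 + 1 ∸ (suc a + suc b) % 2) / 4))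
    × ((a : ℕ) → 1 ≤ a →
    IsDmax (bistar a 1) ((((suc a + 2) + 3) * ((suc a + 2) ∸ 2)) / 2))
    × ((m : ℕ) → 1 ≤ m →
    IsDmax (star m) (suc m C 2))
corollary2 = balancedBistar , quasistar , λ m _ → IsDmax-star m
  where
  balancedBistar : ∀ a b → suc a ≡ ⌈ suc a + suc b /2⌉ →
    IsDmax (bistar a b) ((3 * ((suc a + suc b) ∸ 1) ^ 2 + 1 ∸ (suc a + suc b) % 2) / 4)
  balancedBistar a b balance with balanced-sizes a b balance
  ... | a≤1+b , b≤a = Bistar.IsDmax-balanced a b a≤1+b (m≤n⇒m≤1+n b≤a)
    (m+k*n≡k*w⇒m/k+n≡w 4 {3 * (a + suc b) ^ 2 + 1 ∸ suc (a + suc b) % 2} (4*totalEcc (a + suc b)))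
  quasistar : ∀ a → 1 ≤ a → IsDmax (bistar a 1) ((((suc a + 2) + 3) * ((suc a + 2) ∸ 2)) / 2)
  quasistar a _ = subst (IsDmax (bistar a 1)) (sym (quasistar-value a)) (Quasistar.IsDmax-quasistar a)
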